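{- Consider the generalized Sudoku problem with data $n, \pi_1, \pi_2, \pi_3, i_1, \ldots, i_k, g_{i_1}, \ldots, g_{i_k}$ and solution set $S(n,g)$. Let $J$ be a $p$-$q$-rectangle for some $2 \le p \le n$ and $1 \le q \le n$. Suppose $x$ is the unique solution of the generalized Sudoku problem (i.e., $S(n,g) = \{x\}$) and $x$ is minimal on $J$. Then $J \cap \{i_1, \ldots, i_k\} \ne \emptyset$.
   Context: For $y \in \mathbb{Z}^s$ write $y <> \mathbf{0}$ if every component of $y$ is nonzero. Let $n \ge 2$ and $s(n) = \sum_{i=1}^{n-1} i$. The $s(n) \times n$ matrix $A(n)$ is defined inductively: $A(1)$ is the empty matrix, and $A(m) = \begin{pmatrix} \mathbf{1}_{m-1} & -U_{m-1} \\ \mathbf{0}_{s(m-1)} & A(m-1) \end{pmatrix}$, where $\mathbf{1}_{m-1}$ is the all-ones column, $U_{m-1}$ the identity matrix and $\mathbf{0}_{s(m-1)}$ the zero column of length $s(m-1)$. Let $A$ be the $(n \cdot s(n)) \times n^2$ block-diagonal matrix whose $n$ diagonal blocks all equal $A(n)$. For a permutation $\pi$ of $\{1,\ldots,n^2\}$, $A_\pi$ is the matrix whose $j$-th column is the $\pi^{ -1}(j)$-th column of $A$, and the constraint sets of $\pi$ are $cs_\pi(j) = \{\pi(i) \mid (j-1)n + 1 \le i \le jn\}$, $j=1,\ldots,n$. Generalized Sudoku problem: given permutations $\pi_1, \pi_2, \pi_3$ of $\{1, \ldots, n^2\}$, an integer $0 \le k \le n^2$, an index set $\{i_1, \ldots,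 i_k\} \subset \{1, \ldots, n^2\}$ (the givens' cells) and givens $g_{i_l} \in \mathbb{Z}$ with $1 \le g_{i_l} \le n$, its solution set is $S(n,g) = \{x \in \mathbb{Z}^{n^2} \mid 1 \le x_i \le n \ (i = 1,\ldots,n^2),\ A_{\pi_r}x <> \mathbf{0}\ (r = 1,2,3),\ x_{i_l} = g_{i_l}\ (l = 1, \ldots, k)\}$. For $1 \le p, q \le n$, a set $J \subset \{1, \ldots, n^2\}$ with $p \cdot q$ elements is a $p$-$q$-rectangle if for each $r = 1,2,3$ there exist distinct indices $j_{r,1}, \ldots, j_{r,q} \in \{1, \ldots, n\}$ with $\sharp(J \cap cs_{\pi_r}(j_{r,s})) = p$ for $s = 1, \ldots, q$. A point $x \in S(n,g)$ is minimal on a $p$-$q$-rectangle $J$ if $\sharp\{x_i \mid i \in J\} = p$. -}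

module Defs where

open import Data.Nat as ℕ using (ℕ; zero; suc)
open import Data.Integer as ℤ using (ℤ; +_; -_)
import Data.Integer.Properties as ℤP
open import Data.Fin as Fin using (Fin; zero; suc; splitAt; remQuot; combine)
import Data.Fin.Properties as FinP
open import Data.Fin.Subset using (Subset; _∈_; _∩_; ⋃; ⁅_⁆; ∣_∣)
open import Data.Fin.Subset.Properties using (_∈?_)
open import Data.Fin.Permutation using (Permutation′; _⟨$⟩ʳ_; _⟨$⟩ˡ_)
open import Data.List as List using (List; deduplicate; filter; allFin; length)
open import Data.Sum using (inj₁; inj₂)
open import Data.Product using (_×_; Σ; ∃; _,_; proj₁; proj₂)
open import Function.Definitions using (Injective)
open import Relation.Binary.PropositionalEquality using (_≡_; _≢_)
open import Relation.Nullary using (¬_; yes; no)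

Matrix : ℕ → ℕ → Set
Matrix r c = Fin r → Fin c → ℤ

-- s(m) = Σ_{i=1}^{m-1} i   (s 0 = s 1 = 0, s (m+1) = m + s m)
s : ℕ → ℕ
s zero    = zero
s (suc m) = m ℕ.+ s m

-- Kronecker delta on Fin, as an integer (entries of the identity matrix U)
δ : ∀ {m} → Fin m → Fin m → ℤ
δ i j with i Fin.≟ j
... | yes _ = + 1
... | no  _ = + 0

-- A(m), defined inductively: A(1) (and A(0)) is empty (no rows), and
-- A(m+1) = ( 1_m  | -U_m   )
--          ( 0    | A(m)   )
-- rows split as Fin (m + s m) = first m rows, then s m rows;
-- columns split as first column (zero) and the remaining m columns.
Amat : (m : ℕ) → Matrix (s m) m
Amat zero    ()  c
Amat (suc m) r c with splitAt m r | c
... | inj₁ i | zero  = + 1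
... | inj₁ i | suc j = - δ i j
... | inj₂ t | zero  = + 0
... | inj₂ t | suc j = Amat m t j

-- The block-diagonal (n·s(n)) × n² matrix with n diagonal blocks A(n).
-- Row index R = b·s(n) + r  (block b, local row r), column C = b'·n + c.
Ablock : (n : ℕ) → Matrix (n ℕ.* s n) (n ℕ.* n)
Ablock n R C with remQuot {n} (s n) R | remQuot {n} n C
... | (b , r) | (b' , c) with b Fin.≟ b'
...   | yes _ = Amat n r c
...   | no  _ = + 0

-- Cell indices 1..n² are represented by Fin (n * n) (0-based).
Cell : ℕ → Set
Cell n = Fin (n ℕ.* n)

Aπ : (n : ℕ) → Permutation′ (n ℕ.* n) → Matrix (n ℕ.* s n) (n ℕ.* n)
Aπ n π R j = Ablock n R (π ⟨$⟩ˡ j)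

sumFin : ∀ {m} → (Fin m → ℤ) → ℤ
sumFin {zero}  f = + 0
sumFin {suc m} f = f zero ℤ.+ sumFin (λ i → f (suc i))

_·_ : ∀ {r c} → Matrix r c → (Fin c → ℤ) → (Fin r → ℤ)
(M · x) i = sumFin (λ j → M i j ℤ.* x j)

NonzeroEntries : ∀ {r} → (Fin r → ℤ) → Set
NonzeroEntries y = ∀ i → y i ≢ + 0

-- Membership in the solution set S(n,g).
-- Givens: k cells idx : Fin k → Cell n (injective, i.e. an index set
-- {i_1,…,i_k}) with values g : Fin k → ℤ (g l is g_{i_l}).
InS : (n : ℕ) (π₁ π₂ π₃ : Permutation′ (n ℕ.* n))
      (k : ℕ) (idx : Fin k → Cell n) (g : Fin k → ℤ)
      (x : Cell n → ℤ) → Set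
InS n π₁ π₂ π₃ k idx g x =
  (∀ i → (+ 1 ℤ.≤ x i) × (x i ℤ.≤ + n))
  × NonzeroEntries (Aπ n π₁ · x)
  × NonzeroEntries (Aπ n π₂ · x)
  × NonzeroEntries (Aπ n π₃ · x)
  × (∀ l → x (idx l) ≡ g l)

-- Constraint set cs_π(j) = { π(i) | (j-1)n+1 ≤ i ≤ jn }  (0-based: i = j·n + t).
cs : (n : ℕ) → Permutation′ (n ℕ.* n) → Fin n → Subset (n ℕ.* n)
cs n π j = ⋃ (List.map (λ t → ⁅ π ⟨$⟩ʳ combine {n} {n} j t ⁆) (allFin n))

RectangleFor : (n : ℕ) → Permutation′ (n ℕ.* n) → (p q : ℕ) → Subset (n ℕ.* n) → Set
RectangleFor n π p q J =
  Σ (Fin q → Fin n) λ js → Injective _≡_ _≡_ js × (∀ t → ∣ J ∩ cs n π (js t) ∣ ≡ p)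

IsRectangle : (n : ℕ) (π₁ π₂ π₃ : Permutation′ (n ℕ.* n)) (p q : ℕ) → Subset (n ℕ.* n) → Set
IsRectangle n π₁ π₂ π₃ p q J =
  ∣ J ∣ ≡ p ℕ.* q
  × RectangleFor n π₁ p q J
  × RectangleFor n π₂ p q J
  × RectangleFor n π₃ p q J

elements : ∀ {m} → Subset m → List (Fin m)
elements J = filter (_∈? J) (allFin _)

valueCount : ∀ {m} → (Fin m → ℤ) → Subset m → ℕ
valueCount x J = length (deduplicate ℤ._≟_ (List.map x (elements J)))

MinimalOn : ∀ {m} → (Fin m → ℤ) → ℕ → Subset m → Set
MinimalOn x p J = valueCount x J ≡ p

module Submission where

-- Suppose no given lies in J.  As x takes exactly p ≥ 2 values on J, choose two
-- distinct ones, a and b, and let y be x with a and b exchanged on the cells of J.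
-- Every row of A_π is e_u - e_v for two cells u, v of one constraint set, and every such
-- pair occurs; so A_π z <> 0 says precisely that z is injective on each constraint set.
-- Because J is a rectangle, a constraint set meeting J meets it in exactly p cells; these
-- already carry all p values of x on J, so by the pigeonhole principle no other cell of
-- that set carries one of them.  Hence the exchange keeps z injective on every constraint
-- set, and y also keeps the bounds and the givens: y is a second solution, contradiction.

open import Defs
open import Data.Nat using (ℕ; _≤_; _*_)
open import Data.Integer using (ℤ; +_) renaming (_≤_ to _≤ℤ_)
open import Data.Fin using (Fin)
open import Data.Fin.Subset using (Subset; _∈_)
open import Data.Fin.Permutation using (Permutation′)
open import Data.Product using (∃; _×_)
open import Function.Definitions using (Injective)
open import Relation.Binary.Definitions using (DecidableEquality)
open import Relation.Binary.PropositionalEquality using (_≡_)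

open import Data.Nat as ℕ using (zero; suc)
import Data.Nat.Properties as ℕP
open import Data.Integer as ℤ using (_-_)
import Data.Integer.Properties as ℤP
open import Data.Integer.Solver using (module +-*-Solver)
open import Data.Fin as Fin using (zero; suc; splitAt; remQuot; combine; _↑ˡ_; _↑ʳ_)
import Data.Fin.Properties as FinP
open import Data.Fin.Subset using (_∉_; _∩_; _∪_; ⋃; ⁅_⁆; ∣_∣; inside; outside)
open import Data.Fin.Subset.Properties
  using (_∈?_; x∈⁅x⁆; x∈⁅y⁆⇒x≡y; x∈p∪q⁺; x∈p∪q⁻; x∈p∩q⁺; x∈p∩q⁻; ∉⊥; ∣⊥∣≡0; ∣⁅x⁆∣≡1; p⊆q⇒∣p∣≤∣q∣; x∈p⇒∣p-x∣<∣p∣)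
open import Data.Fin.Permutation using (_⟨$⟩ʳ_; _⟨$⟩ˡ_; inverseˡ; inverseʳ)
open import Data.Vec.Base as Vec using (here; there)
open import Data.List as List using (List; []; _∷_; _++_; allFin; length)
import Data.List.Properties as ListP
open import Data.List.Membership.Propositional using () renaming (_∈_ to _∈ₗ_)
open import Data.List.Membership.Propositional.Properties
  using (∈-allFin; ∈-∃++; ∈-++⁻; ∈-++⁺ˡ; ∈-++⁺ʳ; ∈-map⁺; ∈-map⁻; ∈-filter⁺; ∈-filter⁻)
open import Data.List.Relation.Unary.Unique.Propositional using (Unique)
open import Data.List.Relation.Unary.All using (_∷_)
open import Data.List.Relation.Unary.AllPairs using (_∷_)
import Data.List.Relation.Unary.Unique.DecPropositional.Properties as UniqueP
open import Data.List.Relation.Unary.Any as Any using (Any)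
import Data.List.Relation.Unary.Any.Properties as AnyP
open import Data.Sum using (_⊎_; inj₁; inj₂)
open import Data.Product using (_,_; proj₁; proj₂)
open import Data.Empty using (⊥; ⊥-elim)
open import Relation.Binary.PropositionalEquality
  using (refl; sym; trans; cong; cong₂; subst; _≢_; module ≡-Reasoning)
open import Relation.Nullary using (yes; no)

δ-refl : ∀ {m} (i : Fin m) → δ i i ≡ + 1
δ-refl i with i Fin.≟ i
... | yes _  = refl
... | no i≢i = ⊥-elim (i≢i refl)

δ-≢ : ∀ {m} {i j : Fin m} → i ≢ j → δ i j ≡ + 0
δ-≢ {i = i} {j} i≢j with i Fin.≟ j
... | yes i≡j = ⊥-elim (i≢j i≡j)
... | no _    = refl

δ-injective : ∀ {m k} (f : Fin m → Fin k) → Injective _≡_ _≡_ f →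
              ∀ i j → δ (f i) (f j) ≡ δ i j
δ-injective f f-inj i j with i Fin.≟ j
... | yes refl = δ-refl (f i)
... | no i≢j   = δ-≢ (λ fi≡fj → i≢j (f-inj fi≡fj))

-- Row r of A(m) is e_(plusCol r) - e_(minusCol r), and every pair of distinct columns occurs.

plusCol minusCol : (m : ℕ) → Fin (s m) → Fin m
plusCol (suc m) r with splitAt m r
... | inj₁ i = zero
... | inj₂ t = suc (plusCol m t)
minusCol (suc m) r with splitAt m r
... | inj₁ i = suc i
... | inj₂ t = suc (minusCol m t)

δ-suc : ∀ {m} (i j : Fin m) → δ (suc i) (suc j) ≡ δ i j
δ-suc = δ-injective suc FinP.suc-injective

Amat-row : ∀ m r c → Amat m r c ≡ δ (plusCol m r) c - δ (minusCol m r) c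
Amat-row (suc m) r c with splitAt m r | c
... | inj₁ i | zero  = refl
... | inj₁ i | suc j = trans (cong ℤ.-_ (sym (δ-suc i j))) (sym (ℤP.+-identityˡ (ℤ.- δ (suc i) (suc j))))
... | inj₂ t | zero  = refl
... | inj₂ t | suc j = begin
  Amat m t j                                          ≡⟨ Amat-row m t j ⟩
  δ (plusCol m t) j - δ (minusCol m t) j              ≡⟨ sym (cong₂ _-_ (δ-suc (plusCol m t) j) (δ-suc (minusCol m t) j)) ⟩
  δ (suc (plusCol m t)) (suc j) - δ (suc (minusCol m t)) (suc j) ∎
  where open ≡-Reasoning

plus≢minus : ∀ m r → plusCol m r ≢ minusCol m r
plus≢minus (suc m) r with splitAt m r
... | inj₁ i = λ ()
... | inj₂ t = λ eq → plus≢minus m t (FinP.suc-injective eq)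

module _ {m : ℕ} where
  plusCol-top : ∀ i → plusCol (suc m) (i ↑ˡ s m) ≡ zero
  plusCol-top i rewrite FinP.splitAt-↑ˡ m i (s m) = refl

  minusCol-top : ∀ i → minusCol (suc m) (i ↑ˡ s m) ≡ suc i
  minusCol-top i rewrite FinP.splitAt-↑ˡ m i (s m) = refl

  plusCol-below : ∀ t → plusCol (suc m) (m ↑ʳ t) ≡ suc (plusCol m t)
  plusCol-below t rewrite FinP.splitAt-↑ʳ m (s m) t = refl

  minusCol-below : ∀ t → minusCol (suc m) (m ↑ʳ t) ≡ suc (minusCol m t)
  minusCol-below t rewrite FinP.splitAt-↑ʳ m (s m) t = refl

Compares : (m : ℕ) → Fin (s m) → Fin m → Fin m → Set
Compares m r a c = (plusCol m r ≡ a × minusCol m r ≡ c) ⊎ (plusCol m r ≡ c × minusCol m r ≡ a)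

row-comparing : ∀ m (a c : Fin m) → a ≢ c → ∃ λ r → Compares m r a c
row-comparing (suc m) zero    zero    a≢c = ⊥-elim (a≢c refl)
row-comparing (suc m) zero    (suc i) _   = i ↑ˡ s m , inj₁ (plusCol-top i , minusCol-top i)
row-comparing (suc m) (suc i) zero    _   = i ↑ˡ s m , inj₂ (plusCol-top i , minusCol-top i)
row-comparing (suc m) (suc a) (suc c) a≢c with row-comparing m a c (λ eq → a≢c (cong suc eq))
... | t , inj₁ (p , q) = m ↑ʳ t , inj₁ (trans (plusCol-below t) (cong suc p) , trans (minusCol-below t) (cong suc q))
... | t , inj₂ (p , q) = m ↑ʳ t , inj₂ (trans (plusCol-below t) (cong suc p) , trans (minusCol-below t) (cong suc q))

δ-combine-≢ : ∀ {m k} {b b' : Fin m} (f c : Fin k) → b ≢ b' → δ (combine b f) (combine b' c) ≡ + 0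
δ-combine-≢ {b = b} {b'} f c b≢b' = δ-≢ (λ eq → b≢b' (FinP.combine-injectiveˡ b f b' c eq))

module _ (n : ℕ) where
  blockOf : Fin (n * s n) → Fin n
  blockOf R = proj₁ (remQuot {n} (s n) R)

  localRow : Fin (n * s n) → Fin (s n)
  localRow R = proj₂ (remQuot {n} (s n) R)

  plusCell minusCell : Fin (n * s n) → Cell n
  plusCell  R = combine (blockOf R) (plusCol  n (localRow R))
  minusCell R = combine (blockOf R) (minusCol n (localRow R))

  Ablock-row : ∀ R C → Ablock n R C ≡ δ (plusCell R) C - δ (minusCell R) C
  Ablock-row R C with Fin.quotRem {n} (s n) R | Fin.quotRem {n} n C | FinP.combine-remQuot {n} n C
  ... | r , b | c , b' | refl with b Fin.≟ b'
  ... | yes refl = trans (Amat-row n r c) (sym (cong₂ _-_ (inBlock (plusCol n r)) (inBlock (minusCol n r))))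
    where
    inBlock : ∀ f → δ (combine b f) (combine b c) ≡ δ f c
    inBlock f = δ-injective (combine b) (λ {f} {f'} → FinP.combine-injectiveʳ b f b f') f c
  ... | no b≢b' = sym (cong₂ _-_ (δ-combine-≢ (plusCol n r) c b≢b') (δ-combine-≢ (minusCol n r) c b≢b'))

permute-injective : ∀ {m} (π : Permutation′ m) → Injective _≡_ _≡_ (π ⟨$⟩ʳ_)
permute-injective π {i} {j} eq = trans (sym (inverseˡ π)) (trans (cong (π ⟨$⟩ˡ_) eq) (inverseˡ π))

δ-permute : ∀ {m} (π : Permutation′ m) U j → δ U (π ⟨$⟩ˡ j) ≡ δ (π ⟨$⟩ʳ U) j
δ-permute π U j = begin
  δ U (π ⟨$⟩ˡ j)                      ≡⟨ sym (δ-injective (π ⟨$⟩ʳ_) (permute-injective π) U (π ⟨$⟩ˡ j)) ⟩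
  δ (π ⟨$⟩ʳ U) (π ⟨$⟩ʳ (π ⟨$⟩ˡ j))    ≡⟨ cong (δ (π ⟨$⟩ʳ U)) (inverseʳ π) ⟩
  δ (π ⟨$⟩ʳ U) j                      ∎
  where open ≡-Reasoning

sumFin-cong : ∀ {m} {f g : Fin m → ℤ} → (∀ i → f i ≡ g i) → sumFin f ≡ sumFin g
sumFin-cong {zero}  eq = refl
sumFin-cong {suc m} eq = cong₂ ℤ._+_ (eq zero) (sumFin-cong (λ i → eq (suc i)))

sumFin-- : ∀ {m} (f g : Fin m → ℤ) → sumFin (λ i → f i - g i) ≡ sumFin f - sumFin g
sumFin-- {zero}  f g = refl
sumFin-- {suc m} f g = trans (cong (λ t → (f zero - g zero) ℤ.+ t) (sumFin-- (λ i → f (suc i)) (λ i → g (suc i))))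
                             (regroup (f zero) (g zero) _ _)
  where
  open +-*-Solver
  regroup : ∀ a b c d → (a - b) ℤ.+ (c - d) ≡ (a ℤ.+ c) - (b ℤ.+ d)
  regroup = solve 4 (λ a b c d → (a :- b) :+ (c :- d) := (a :+ c) :- (b :+ d)) refl

sumFin-δ : ∀ {m} (u : Fin m) (z : Fin m → ℤ) → sumFin (λ j → δ u j ℤ.* z j) ≡ z u
sumFin-δ {suc m} zero    z = trans (cong₂ ℤ._+_ (ℤP.*-identityˡ (z zero)) (sumFin-zero m {λ j → z (suc j)})) (ℤP.+-identityʳ (z zero))
  where
  sumFin-zero : ∀ k {w : Fin k → ℤ} → sumFin (λ j → δ {suc k} zero (suc j) ℤ.* w j) ≡ + 0
  sumFin-zero zero        = refl
  sumFin-zero (suc k) {w} = trans (ℤP.+-identityˡ _) (sumFin-zero k {λ j → w (suc j)})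
sumFin-δ {suc m} (suc u) z = begin
  + 0 ℤ.+ sumFin (λ j → δ (suc u) (suc j) ℤ.* z (suc j)) ≡⟨ ℤP.+-identityˡ _ ⟩
  sumFin (λ j → δ (suc u) (suc j) ℤ.* z (suc j))         ≡⟨ sumFin-cong (λ j → cong (ℤ._* z (suc j)) (δ-suc u j)) ⟩
  sumFin (λ j → δ u j ℤ.* z (suc j))                     ≡⟨ sumFin-δ u (λ j → z (suc j)) ⟩
  z (suc u)                                              ∎
  where open ≡-Reasoning

module _ (n : ℕ) (π : Permutation′ (n * n)) where
  Aπ-row : ∀ (z : Cell n → ℤ) R →
           (Aπ n π · z) R ≡ z (π ⟨$⟩ʳ plusCell n R) - z (π ⟨$⟩ʳ minusCell n R)
  Aπ-row z R = begin
    sumFin (λ j → Ablock n R (π ⟨$⟩ˡ j) ℤ.* z j)            ≡⟨ sumFin-cong (λ j → cong (ℤ._* z j) (entry j)) ⟩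
    sumFin (λ j → (δ u j - δ v j) ℤ.* z j)                  ≡⟨ sumFin-cong (λ j → sub-distrib (δ u j) (δ v j) (z j)) ⟩
    sumFin (λ j → δ u j ℤ.* z j - δ v j ℤ.* z j)            ≡⟨ sumFin-- (λ j → δ u j ℤ.* z j) (λ j → δ v j ℤ.* z j) ⟩
    sumFin (λ j → δ u j ℤ.* z j) - sumFin (λ j → δ v j ℤ.* z j) ≡⟨ cong₂ _-_ (sumFin-δ u z) (sumFin-δ v z) ⟩
    z u - z v                                               ∎
    where
    open ≡-Reasoning
    u = π ⟨$⟩ʳ plusCell n R
    v = π ⟨$⟩ʳ minusCell n R
    sub-distrib : ∀ a b c → (a - b) ℤ.* c ≡ a ℤ.* c - b ℤ.* c
    sub-distrib = solve 3 (λ a b c → (a :- b) :* c := a :* c :- b :* c) refl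
      where open +-*-Solver
    entry : ∀ j → Ablock n R (π ⟨$⟩ˡ j) ≡ δ u j - δ v j
    entry j = trans (Ablock-row n R (π ⟨$⟩ˡ j))
                    (cong₂ _-_ (δ-permute π (plusCell n R) j) (δ-permute π (minusCell n R) j))

∈-⋃⁺ : ∀ {m} {L : List (Subset m)} {w} → Any (w ∈_) L → w ∈ ⋃ L
∈-⋃⁺ (Any.here w∈T)  = x∈p∪q⁺ (inj₁ w∈T)
∈-⋃⁺ (Any.there w∈L) = x∈p∪q⁺ (inj₂ (∈-⋃⁺ w∈L))

∈-⋃⁻ : ∀ {m} (L : List (Subset m)) {w} → w ∈ ⋃ L → Any (w ∈_) L
∈-⋃⁻ []      w∈⋃ = ⊥-elim (∉⊥ w∈⋃)
∈-⋃⁻ (T ∷ L) w∈⋃ with x∈p∪q⁻ T (⋃ L) w∈⋃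
... | inj₁ w∈T = Any.here w∈T
... | inj₂ w∈L = Any.there (∈-⋃⁻ L w∈L)

InjectiveOn : ∀ {a m} {A : Set a} → (Fin m → A) → Subset m → Set a
InjectiveOn z T = ∀ {u v} → u ∈ T → v ∈ T → z u ≡ z v → u ≡ v

Disjoint : ∀ {m} → Subset m → Subset m → Set
Disjoint P Q = ∀ {w} → w ∈ P → w ∉ Q

∣∪∣-disjoint : ∀ {m} (P Q : Subset m) → Disjoint P Q → ∣ P ∪ Q ∣ ≡ ∣ P ∣ ℕ.+ ∣ Q ∣
∣∪∣-disjoint Vec.[]            Vec.[]            _ = refl
∣∪∣-disjoint (inside  Vec.∷ P) (inside  Vec.∷ Q) d = ⊥-elim (d here here)
∣∪∣-disjoint (inside  Vec.∷ P) (outside Vec.∷ Q) d = cong suc (∣∪∣-disjoint P Q (λ p q → d (there p) (there q)))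
∣∪∣-disjoint (outside Vec.∷ P) (inside  Vec.∷ Q) d =
  trans (cong suc (∣∪∣-disjoint P Q (λ p q → d (there p) (there q)))) (sym (ℕP.+-suc ∣ P ∣ ∣ Q ∣))
∣∪∣-disjoint (outside Vec.∷ P) (outside Vec.∷ Q) d = ∣∪∣-disjoint P Q (λ p q → d (there p) (there q))

pigeonhole : ∀ {m a} {A : Set a} (T : Subset m) (z : Fin m → A) (V : List A) →
             InjectiveOn z T → (∀ {w} → w ∈ T → z w ∈ₗ V) → ∣ T ∣ ≤ length V
pigeonhole Vec.[]            z V inj into = ℕ.z≤n
pigeonhole (outside Vec.∷ T) z V inj into =
  pigeonhole T (λ w → z (suc w)) V (λ u v eq → FinP.suc-injective (inj (there u) (there v) eq)) (λ w → into (there w))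
pigeonhole (inside  Vec.∷ T) z V inj into with ∈-∃++ (into here)
... | ys , zs , refl = begin
  suc ∣ T ∣                      ≤⟨ ℕ.s≤s (pigeonhole T (λ w → z (suc w)) (ys ++ zs) inj′ into′) ⟩
  suc (length (ys ++ zs))        ≡⟨ sym (ListP.length-++-sucʳ ys (z zero) zs) ⟩
  length (ys ++ z zero ∷ zs)     ∎
  where
  open ℕP.≤-Reasoning
  inj′ : InjectiveOn (λ w → z (suc w)) T
  inj′ u v eq = FinP.suc-injective (inj (there u) (there v) eq)
  -- the value z zero is used up by the cell zero
  into′ : ∀ {w} → w ∈ T → z (suc w) ∈ₗ ys ++ zs
  into′ {w} w∈T with ∈-++⁻ ys (into (there w∈T))
  ... | inj₁ p                = ∈-++⁺ˡ p
  ... | inj₂ (Any.here eq)    = ⊥-elim (FinP.0≢1+n (sym (inj (there w∈T) here eq)))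
  ... | inj₂ (Any.there p)    = ∈-++⁺ʳ ys p

fresh-value : ∀ {m a} {A : Set a} (z : Fin m → A) (B J : Subset m) (V : List A) →
              InjectiveOn z B → (∀ {w} → w ∈ J → z w ∈ₗ V) → ∣ J ∩ B ∣ ≡ length V →
              ∀ {c} → c ∈ B → c ∉ J → z c ∈ₗ V → ⊥
fresh-value z B J V inj into full {c} c∈B c∉J zc∈V = ℕP.n≮n (length V) (begin-strict
  length V              ≡⟨ sym full ⟩
  ∣ J ∩ B ∣             <⟨ ℕP.≤-reflexive (ℕP.+-comm 1 ∣ J ∩ B ∣) ⟩
  ∣ J ∩ B ∣ ℕ.+ 1       ≡⟨ sym (trans (∣∪∣-disjoint (J ∩ B) ⁅ c ⁆ c-new) (cong (∣ J ∩ B ∣ ℕ.+_) (∣⁅x⁆∣≡1 c))) ⟩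
  ∣ T ∣                 ≤⟨ pigeonhole T z V (λ u v → inj (T⊆B u) (T⊆B v)) T-into ⟩
  length V              ∎)
  where
  open ℕP.≤-Reasoning
  T = (J ∩ B) ∪ ⁅ c ⁆
  c-new : Disjoint (J ∩ B) ⁅ c ⁆
  c-new w∈J∩B w∈⁅c⁆ with x∈⁅y⁆⇒x≡y c w∈⁅c⁆
  ... | refl = c∉J (proj₁ (x∈p∩q⁻ J B w∈J∩B))
  T⊆B : ∀ {w} → w ∈ T → w ∈ B
  T⊆B w∈T with x∈p∪q⁻ (J ∩ B) ⁅ c ⁆ w∈T
  ... | inj₁ w∈J∩B = proj₂ (x∈p∩q⁻ J B w∈J∩B)
  ... | inj₂ w∈⁅c⁆ with x∈⁅y⁆⇒x≡y c w∈⁅c⁆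
  ... | refl = c∈B
  T-into : ∀ {w} → w ∈ T → z w ∈ₗ V
  T-into w∈T with x∈p∪q⁻ (J ∩ B) ⁅ c ⁆ w∈T
  ... | inj₁ w∈J∩B = into (proj₁ (x∈p∩q⁻ J B w∈J∩B))
  ... | inj₂ w∈⁅c⁆ with x∈⁅y⁆⇒x≡y c w∈⁅c⁆
  ... | refl = zc∈V

∣⋃∣-disjoint : ∀ {m} q p (f : Fin q → Subset m) → (∀ {s t} → s ≢ t → Disjoint (f s) (f t)) →
               (∀ t → ∣ f t ∣ ≡ p) → ∣ ⋃ (List.tabulate f) ∣ ≡ q * p
∣⋃∣-disjoint {m} zero    p f disj size = ∣⊥∣≡0 m
∣⋃∣-disjoint     (suc q) p f disj size = begin
  ∣ f zero ∪ ⋃ (List.tabulate (λ t → f (suc t))) ∣  ≡⟨ ∣∪∣-disjoint _ _ head-disjoint ⟩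
  ∣ f zero ∣ ℕ.+ ∣ ⋃ (List.tabulate (λ t → f (suc t))) ∣
    ≡⟨ cong₂ ℕ._+_ (size zero) (∣⋃∣-disjoint q p (λ t → f (suc t)) (λ s≢t → disj (λ eq → s≢t (FinP.suc-injective eq))) (λ t → size (suc t))) ⟩
  p ℕ.+ q * p                                       ∎
  where
  open ≡-Reasoning
  head-disjoint : Disjoint (f zero) (⋃ (List.tabulate (λ t → f (suc t))))
  head-disjoint w∈f0 w∈⋃ with AnyP.tabulate⁻ {f = λ t → f (suc t)} (∈-⋃⁻ _ w∈⋃)
  ... | t , w∈ft = disj (λ ()) w∈f0 w∈ft

-- Let the blocks B b be pairwise disjoint, and let J (with |J| = p·q) meet q distinct blocks
-- in exactly p cells each.  Then these account for all of J, so every block meeting J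
-- meets it in exactly p cells.
rectangle-block : ∀ {m n} (B : Fin n → Subset m) → (∀ {b b'} → b ≢ b' → Disjoint (B b) (B b')) →
  ∀ (J : Subset m) p q → ∣ J ∣ ≡ p * q →
  (js : Fin q → Fin n) → Injective _≡_ _≡_ js → (∀ t → ∣ J ∩ B (js t) ∣ ≡ p) →
  ∀ {b w} → w ∈ J → w ∈ B b → ∣ J ∩ B b ∣ ≡ p
rectangle-block B B-disjoint J p q ∣J∣≡pq js js-inj size {b} {w} w∈J w∈B
  with FinP.any? (λ t → js t Fin.≟ b)
... | yes (t , refl) = size t
... | no b∉js = ⊥-elim (ℕP.<⇒≱ (ℕP.≤-<-trans ℕ.z≤n (x∈p⇒∣p-x∣<∣p∣ w∈J∩B)) (ℕP.+-cancelʳ-≤ (q * p) _ 0 (begin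
  ∣ J ∩ B b ∣ ℕ.+ q * p    ≡⟨ sym (cong (∣ J ∩ B b ∣ ℕ.+_) (∣⋃∣-disjoint q p chosen chosen-disjoint size)) ⟩
  ∣ J ∩ B b ∣ ℕ.+ ∣ U ∣    ≡⟨ sym (∣∪∣-disjoint (J ∩ B b) U other-disjoint) ⟩
  ∣ (J ∩ B b) ∪ U ∣        ≤⟨ p⊆q⇒∣p∣≤∣q∣ inJ ⟩
  ∣ J ∣                    ≡⟨ trans ∣J∣≡pq (ℕP.*-comm p q) ⟩
  q * p                    ∎)))
  where
  open ℕP.≤-Reasoning
  w∈J∩B = x∈p∩q⁺ (w∈J , w∈B)
  chosen : Fin q → Subset _
  chosen t = J ∩ B (js t)
  U = ⋃ (List.tabulate chosen)
  chosen-disjoint : ∀ {s t} → s ≢ t → Disjoint (chosen s) (chosen t)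
  chosen-disjoint {s} {t} s≢t u∈s u∈t =
    B-disjoint (λ eq → s≢t (js-inj eq)) (proj₂ (x∈p∩q⁻ J _ u∈s)) (proj₂ (x∈p∩q⁻ J _ u∈t))
  other-disjoint : Disjoint (J ∩ B b) U
  other-disjoint u∈b u∈U with AnyP.tabulate⁻ {f = chosen} (∈-⋃⁻ _ u∈U)
  ... | t , u∈t = B-disjoint (λ b≡jst → b∉js (t , sym b≡jst)) (proj₂ (x∈p∩q⁻ J _ u∈b)) (proj₂ (x∈p∩q⁻ J _ u∈t))
  inJ : ∀ {u} → u ∈ (J ∩ B b) ∪ U → u ∈ J
  inJ u∈ with x∈p∪q⁻ (J ∩ B b) U u∈
  ... | inj₁ u∈b = proj₁ (x∈p∩q⁻ J _ u∈b)
  ... | inj₂ u∈U with AnyP.tabulate⁻ {f = chosen} (∈-⋃⁻ _ u∈U)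
  ... | t , u∈t = proj₁ (x∈p∩q⁻ J _ u∈t)

-- Each constraint set is the image of one block of cells; the constraints A_π z <> 0
-- say that z is injective on each of them.

module Blocks (n : ℕ) (π : Permutation′ (n * n)) where
  cell : Fin n → Fin n → Cell n
  cell b a = π ⟨$⟩ʳ combine b a

  cell-injective : ∀ {b a b' c} → cell b a ≡ cell b' c → b ≡ b' × a ≡ c
  cell-injective {b} {a} {b'} {c} eq =
    FinP.combine-injectiveˡ b a b' c same , FinP.combine-injectiveʳ b a b' c same
    where same = permute-injective π eq

  cell∈cs : ∀ b a → cell b a ∈ cs n π b
  cell∈cs b a = ∈-⋃⁺ (AnyP.map⁺ (Any.map (λ { refl → x∈⁅x⁆ (cell b a) }) (∈-allFin a)))

  cs⇒cell : ∀ {b w} → w ∈ cs n π b → ∃ λ a → w ≡ cell b a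
  cs⇒cell {b} {w} w∈cs with Any.satisfied (AnyP.map⁻ {xs = allFin n} (∈-⋃⁻ _ w∈cs))
  ... | a , w∈⁅cell⁆ = a , x∈⁅y⁆⇒x≡y (cell b a) w∈⁅cell⁆

  cs-disjoint : ∀ {b b'} → b ≢ b' → Disjoint (cs n π b) (cs n π b')
  cs-disjoint b≢b' w∈b w∈b' with cs⇒cell w∈b | cs⇒cell w∈b'
  ... | a , refl | c , eq = b≢b' (proj₁ (cell-injective eq))

  row-in-block : ∀ (z : Cell n → ℤ) b r →
    (Aπ n π · z) (combine b r) ≡ z (cell b (plusCol n r)) - z (cell b (minusCol n r))
  row-in-block z b r = trans (Aπ-row n π z (combine b r))
    (cong (λ (b , r) → z (cell b (plusCol n r)) - z (cell b (minusCol n r))) (FinP.remQuot-combine b r))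

  nonzero⇒injectiveOn : ∀ z → NonzeroEntries (Aπ n π · z) → ∀ b → InjectiveOn z (cs n π b)
  nonzero⇒injectiveOn z nz b u∈cs v∈cs zu≡zv with cs⇒cell u∈cs | cs⇒cell v∈cs
  ... | a , refl | c , refl with a Fin.≟ c
  ... | yes refl = refl
  ... | no a≢c with row-comparing n a c a≢c
  ... | r , compares = ⊥-elim (nz (combine b r) (trans (row-in-block z b r) (ℤP.i≡j⇒i-j≡0 (equal compares))))
    where
    equal : Compares n r a c → z (cell b (plusCol n r)) ≡ z (cell b (minusCol n r))
    equal (inj₁ (refl , refl)) = zu≡zv
    equal (inj₂ (refl , refl)) = sym zu≡zv

  injectiveOn⇒nonzero : ∀ z → (∀ b → InjectiveOn z (cs n π b)) → NonzeroEntries (Aπ n π · z)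
  injectiveOn⇒nonzero z inj R row≡0 = plus≢minus n (localRow n R) (proj₂ (cell-injective same-cell))
    where
    b = blockOf n R
    same-cell : cell b (plusCol n (localRow n R)) ≡ cell b (minusCol n (localRow n R))
    same-cell = inj b (cell∈cs b _) (cell∈cs b _) (ℤP.i-j≡0⇒i≡j _ _ (trans (sym (Aπ-row n π z R)) row≡0))

module Transposition {a} {A : Set a} (_≟_ : DecidableEquality A) (x y : A) where
  swap : A → A
  swap z with z ≟ x | z ≟ y
  ... | yes _ | _     = y
  ... | no _  | yes _ = x
  ... | no _  | no _  = z

  swap-x : swap x ≡ y
  swap-x with x ≟ x
  ... | yes _  = refl
  ... | no x≢x = ⊥-elim (x≢x refl)

  swap-y : swap y ≡ x
  swap-y with y ≟ x | y ≟ y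
  ... | yes refl | _      = refl
  ... | no _     | yes _  = refl
  ... | no _     | no y≢y = ⊥-elim (y≢y refl)

  swap-cases : ∀ z → swap z ≡ y ⊎ swap z ≡ x ⊎ swap z ≡ z
  swap-cases z with z ≟ x | z ≟ y
  ... | yes _ | _     = inj₁ refl
  ... | no _  | yes _ = inj₂ (inj₁ refl)
  ... | no _  | no _  = inj₂ (inj₂ refl)

  swap-involutive : ∀ z → swap (swap z) ≡ z
  swap-involutive z with z ≟ x | z ≟ y
  ... | yes refl | _        = swap-y
  ... | no _     | yes refl = swap-x
  ... | no z≢x   | no z≢y   with z ≟ x | z ≟ y
  ...   | yes z≡x | _       = ⊥-elim (z≢x z≡x)
  ...   | no _    | yes z≡y = ⊥-elim (z≢y z≡y)
  ...   | no _    | no _    = refl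

  swap-injective : Injective _≡_ _≡_ swap
  swap-injective {u} {v} eq = begin
    u               ≡⟨ sym (swap-involutive u) ⟩
    swap (swap u)   ≡⟨ cong swap eq ⟩
    swap (swap v)   ≡⟨ swap-involutive v ⟩
    v               ∎
    where open ≡-Reasoning

relabelOn : ∀ {m a} {A : Set a} → Subset m → (A → A) → (Fin m → A) → Fin m → A
relabelOn J σ z w with w ∈? J
... | yes _ = σ (z w)
... | no _  = z w

module _ {m a} {A : Set a} (J : Subset m) (σ : A → A) (z : Fin m → A) where
  relabel-cases : ∀ w → (w ∈ J × relabelOn J σ z w ≡ σ (z w)) ⊎ (w ∉ J × relabelOn J σ z w ≡ z w)
  relabel-cases w with w ∈? J
  ... | yes w∈J = inj₁ (w∈J , refl)
  ... | no w∉J  = inj₂ (w∉J , refl)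

  relabel-inside : ∀ {w} → w ∈ J → relabelOn J σ z w ≡ σ (z w)
  relabel-inside {w} w∈J with relabel-cases w
  ... | inj₁ (_ , eq)    = eq
  ... | inj₂ (w∉J , _)   = ⊥-elim (w∉J w∈J)

  relabel-outside : ∀ {w} → w ∉ J → relabelOn J σ z w ≡ z w
  relabel-outside {w} w∉J with relabel-cases w
  ... | inj₁ (w∈J , _)   = ⊥-elim (w∉J w∈J)
  ... | inj₂ (_ , eq)    = eq

  relabel-injectiveOn : ∀ (B : Subset m) (V : List A) → InjectiveOn z B → Injective _≡_ _≡_ σ →
    (∀ {v} → v ∈ₗ V → σ v ∈ₗ V) → (∀ {w} → w ∈ J → z w ∈ₗ V) →
    (∀ {u c} → u ∈ J → u ∈ B → c ∈ B → c ∉ J → z c ∈ₗ V → ⊥) →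
    InjectiveOn (relabelOn J σ z) B
  relabel-injectiveOn B V inj σ-inj σ-V into fresh {u} {v} u∈B v∈B eq
    with relabel-cases u | relabel-cases v
  ... | inj₁ (u∈J , yu) | inj₁ (v∈J , yv) = inj u∈B v∈B (σ-inj (trans (sym yu) (trans eq yv)))
  ... | inj₂ (u∉J , yu) | inj₂ (v∉J , yv) = inj u∈B v∈B (trans (sym yu) (trans eq yv))
  ... | inj₁ (u∈J , yu) | inj₂ (v∉J , yv) =
    ⊥-elim (fresh u∈J u∈B v∈B v∉J (subst (_∈ₗ V) (trans (sym yu) (trans eq yv)) (σ-V (into u∈J))))
  ... | inj₂ (u∉J , yu) | inj₁ (v∈J , yv) =
    ⊥-elim (fresh v∈J v∈B u∈B u∉J (subst (_∈ₗ V) (trans (sym yv) (trans (sym eq) yu)) (σ-V (into v∈J))))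

  relabel-values : (∀ {w} → w ∈ J → ∃ λ w' → σ (z w) ≡ z w') → ∀ w → ∃ λ w' → relabelOn J σ z w ≡ z w'
  relabel-values σ-values w with relabel-cases w
  ... | inj₁ (w∈J , yw) = let w' , eq = σ-values w∈J in w' , trans yw eq
  ... | inj₂ (_ , yw)   = w , yw

-- The list of distinct values of x on J; MinimalOn x p J says it has length p.
valuesOn : ∀ {m} → (Fin m → ℤ) → Subset m → List ℤ
valuesOn x J = List.deduplicate ℤ._≟_ (List.map x (elements J))

module _ {m} (x : Fin m → ℤ) (J : Subset m) where
  valuesOn-unique : Unique (valuesOn x J)
  valuesOn-unique = UniqueP.deduplicate-! ℤ._≟_ (List.map x (elements J))

  valuesOn⁺ : ∀ {w} → w ∈ J → x w ∈ₗ valuesOn x J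
  valuesOn⁺ w∈J = AnyP.deduplicate⁺ ℤ._≟_ (λ eq v≡ → trans v≡ (sym eq))
    (∈-map⁺ x (∈-filter⁺ (_∈? J) (∈-allFin _) w∈J))

  valuesOn⁻ : ∀ {v} → v ∈ₗ valuesOn x J → ∃ λ w → w ∈ J × v ≡ x w
  valuesOn⁻ v∈ with ∈-map⁻ x (AnyP.deduplicate⁻ ℤ._≟_ v∈)
  ... | w , w∈elements , v≡xw = w , proj₂ (∈-filter⁻ (_∈? J) {xs = allFin m} w∈elements) , v≡xw

two-distinct : ∀ {a} {A : Set a} (L : List A) → Unique L → 2 ≤ length L →
               ∃ λ u → ∃ λ v → u ∈ₗ L × v ∈ₗ L × u ≢ v
two-distinct []          _ ()
two-distinct (u ∷ [])    _ (ℕ.s≤s ())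
two-distinct (u ∷ v ∷ _) ((u≢v ∷ _) ∷ _) _ =
  u , v , Any.here refl , Any.there (Any.here refl) , u≢v

module Exchange (n : ℕ) (J : Subset (n * n)) (x : Cell n → ℤ) {a b : ℤ}
                (a∈J : a ∈ₗ valuesOn x J) (b∈J : b ∈ₗ valuesOn x J) where
  open Transposition ℤ._≟_ a b

  exchanged : Cell n → ℤ
  exchanged = relabelOn J swap x

  swap-valuesOn : ∀ {v} → v ∈ₗ valuesOn x J → swap v ∈ₗ valuesOn x J
  swap-valuesOn {v} v∈J with swap-cases v
  ... | inj₁ eq        = subst (_∈ₗ valuesOn x J) (sym eq) b∈J
  ... | inj₂ (inj₁ eq) = subst (_∈ₗ valuesOn x J) (sym eq) a∈J
  ... | inj₂ (inj₂ eq) = subst (_∈ₗ valuesOn x J) (sym eq) v∈J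

  -- If x is minimal on the p-q-rectangle J, every constraint set meeting J already carries
  -- all values of x on J, so the exchange keeps x injective on each constraint set.
  exchange-nonzero : ∀ π p q → ∣ J ∣ ≡ p * q → RectangleFor n π p q J → MinimalOn x p J →
    NonzeroEntries (Aπ n π · x) → NonzeroEntries (Aπ n π · exchanged)
  exchange-nonzero π p q ∣J∣≡pq (js , js-inj , size) minimal nz =
    injectiveOn⇒nonzero exchanged λ blk →
      relabel-injectiveOn J swap x (cs n π blk) (valuesOn x J) (injective blk) swap-injective
        swap-valuesOn (valuesOn⁺ x J) (fresh blk)
    where
    open Blocks n π
    injective : ∀ blk → InjectiveOn x (cs n π blk)
    injective = nonzero⇒injectiveOn x nz
    fresh : ∀ blk {u c} → u ∈ J → u ∈ cs n π blk → c ∈ cs n π blk → c ∉ J → x c ∈ₗ valuesOn x J → ⊥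
    fresh blk u∈J u∈blk = fresh-value x (cs n π blk) J (valuesOn x J) (injective blk) (valuesOn⁺ x J)
      (trans (rectangle-block (cs n π) cs-disjoint J p q ∣J∣≡pq js js-inj size u∈J u∈blk) (sym minimal))

  exchange-solution : ∀ π₁ π₂ π₃ k idx g p q → IsRectangle n π₁ π₂ π₃ p q J → MinimalOn x p J →
    (∀ l → idx l ∉ J) → InS n π₁ π₂ π₃ k idx g x → InS n π₁ π₂ π₃ k idx g exchanged
  exchange-solution π₁ π₂ π₃ k idx g p q (∣J∣≡pq , rect₁ , rect₂ , rect₃) minimal givens∉J
                    (bounds , nz₁ , nz₂ , nz₃ , givens) =
      (λ w → let w' , eq = relabel-values J swap x swap-is-value w in
             subst (λ v → (+ 1 ≤ℤ v) × (v ≤ℤ + n)) (sym eq) (bounds w'))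
    , exchange-nonzero π₁ p q ∣J∣≡pq rect₁ minimal nz₁
    , exchange-nonzero π₂ p q ∣J∣≡pq rect₂ minimal nz₂
    , exchange-nonzero π₃ p q ∣J∣≡pq rect₃ minimal nz₃
    , (λ l → trans (relabel-outside J swap x (givens∉J l)) (givens l))
    where
    swap-is-value : ∀ {w} → w ∈ J → ∃ λ w' → swap (x w) ≡ x w'
    swap-is-value w∈J with valuesOn⁻ x J (swap-valuesOn (valuesOn⁺ x J w∈J))
    ... | w' , _ , eq = w' , eq

theorem6p2 : (n : ℕ) → 2 ≤ n →
    (π₁ π₂ π₃ : Permutation′ (n * n)) →
    (k : ℕ) → k ≤ n * n →
    (idx : Fin k → Cell n) → Injective _≡_ _≡_ idx →
    (g : Fin k → ℤ) → (∀ l → (+ 1 ≤ℤ g l) × (g l ≤ℤ + n)) →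
    (p q : ℕ) → 2 ≤ p → p ≤ n → 1 ≤ q → q ≤ n →
    (J : Subset (n * n)) → IsRectangle n π₁ π₂ π₃ p q J →
    (x : Cell n → ℤ) →
    InS n π₁ π₂ π₃ k idx g x →
    (∀ y → InS n π₁ π₂ π₃ k idx g y → ∀ i → y i ≡ x i) →
    MinimalOn x p J →
    ∃ λ l → idx l ∈ J
theorem6p2 n _ π₁ π₂ π₃ k _ idx _ g _ p q 2≤p _ _ _ J rectangle x x∈S unique minimal
  with FinP.any? (λ l → idx l ∈? J)
... | yes given∈J = given∈J
... | no no-given with two-distinct (valuesOn x J) (valuesOn-unique x J) (subst (2 ≤_) (sym minimal) 2≤p)
... | a , b , a∈J , b∈J , a≢b with valuesOn⁻ x J a∈J
... | w , w∈J , a≡xw = ⊥-elim (a≢b (begin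
  a                ≡⟨ a≡xw ⟩
  x w              ≡⟨ sym (unique exchanged exchanged∈S w) ⟩
  exchanged w      ≡⟨ relabel-inside J swap x w∈J ⟩
  swap (x w)       ≡⟨ cong swap (sym a≡xw) ⟩
  swap a           ≡⟨ swap-x ⟩
  b                ∎))
  where
  open ≡-Reasoning
  open Transposition ℤ._≟_ a b
  open Exchange n J x a∈J b∈J
  exchanged∈S : InS n π₁ π₂ π₃ k idx g exchanged
  exchanged∈S = exchange-solution π₁ π₂ π₃ k idx g p q rectangle minimal (λ l l∈J → no-given (l , l∈J)) x∈S
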